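{- A function $f:\{0,1\}^n\to\{0,1\}$ is an anti-monotone conjunction if and only if $f^{ -1}(1)$ is anti-monotone and is a linear subspace of $\{0,1\}^n=\mathbb{F}_2^n$.
   Context: An anti-monotone conjunction is a conjunction of negated variables $\overline{x_{i_1}}\wedge\cdots\wedge\overline{x_{i_k}}$ (for some $k\ge 0$). A set $H\subseteq\{0,1\}^n$ is anti-monotone if whenever $x\in H$ and $y\preceq x$ (i.e. $y_i\le x_i$ for all $i$) we have $y\in H$. $\{0,1\}^n$ is identified with $\mathbb{F}_2^n$, with addition being coordinatewise XOR $\oplus$. -}

module Defs where

open import Data.Nat using (ℕ)
open import Data.Bool using (Bool; true; false; _∧_; _xor_; not; _≤_)
open import Data.Vec using (Vec; []; _∷_; lookup; zipWith; replicate; map)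
open import Data.Fin using (Fin)
open import Data.Fin.Subset using (Subset)
open import Relation.Binary.PropositionalEquality using (_≡_)
open import Data.Product using (_×_; ∃)

-- {0,1}^n identified with F₂^n : vectors of Bool (false = 0, true = 1).
-- F₂ addition is xor, F₂ multiplication is ∧.
Cube : ℕ → Set
Cube n = Vec Bool n

_⊕_ : ∀ {n} → Cube n → Cube n → Cube n
_⊕_ = zipWith _xor_

𝟎 : ∀ {n} → Cube n
𝟎 = replicate _ false

_·_ : ∀ {n} → Bool → Cube n → Cube n
c · x = map (c ∧_) x

-- coordinatewise order y ⪯ x  (y_i ≤ x_i for all i), Data.Bool._≤_ has false ≤ true
_⪯_ : ∀ {n} → Cube n → Cube n → Set
y ⪯ x = ∀ i → lookup y i ≤ lookup x i

Pred : ℕ → Set₁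
Pred n = Cube n → Set

preimage1 : ∀ {n} → (Cube n → Bool) → Pred n
preimage1 f x = f x ≡ true

AntiMonotone : ∀ {n} → Pred n → Set
AntiMonotone H = ∀ x y → H x → y ⪯ x → H y

IsSubspace : ∀ {n} → Pred n → Set
IsSubspace H = H 𝟎 × (∀ x y → H x → H y → H (x ⊕ y)) × (∀ c x → H x → H (c · x))

-- the anti-monotone conjunction ⋀_{i ∈ S} ¬x_i, for S ⊆ [n] given as a Subset
-- (Subset n = Vec Bool n, true = inside); S = ∅ gives the constant 1 (k = 0)
conjNeg : ∀ {n} → Subset n → Cube n → Bool
conjNeg [] [] = true
conjNeg (s ∷ ss) (b ∷ bs) = not (s ∧ b) ∧ conjNeg ss bs

IsAntiMonotoneConj : ∀ {n} → (Cube n → Bool) → Set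
IsAntiMonotoneConj {n} f = ∃ λ (S : Subset n) → ∀ x → f x ≡ conjNeg S x

-- A vector lies in f⁻¹(1) for f = ⋀_{i ∈ S} ¬xᵢ exactly when its support avoids S, and the
-- vectors supported in a fixed set of coordinates form a downward-closed subspace.
-- Conversely, a downward-closed subspace H contains x iff it contains the unit vector eᵢ of
-- every coordinate i in the support of x: "only if" by downward closure, since eᵢ ⪯ x, and
-- "if" because x is the sum of these unit vectors. So H is the set of vectors avoiding
-- S = {i | eᵢ ∉ H}, which is the preimage of 1 under the conjunction over S.
module Submission where

open import Defs
open import Data.Nat using (ℕ; zero; suc)
open import Data.Bool using (Bool; true; false; _∧_; _xor_; not; _≤_; b≤b)
open import Data.Bool.Properties using (≤-minimum; not-involutive; xor-identityˡ; ⇔→≡)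
open import Data.Vec using ([]; _∷_; lookup; tabulate)
open import Data.Vec.Properties
  using (lookup-replicate; lookup-zipWith; lookup-map; lookup∘tabulate; zipWith-identityˡ)
open import Data.Fin using (Fin; zero; suc)
open import Data.Fin.Subset using (Subset; ⁅_⁆)
open import Data.Product using (_×_; _,_; proj₁; proj₂)
open import Data.Sum using (_⊎_; inj₁; inj₂; [_,_]′)
open import Function.Bundles using (_⇔_; mk⇔)
open import Relation.Binary.PropositionalEquality
  using (_≡_; _≗_; refl; sym; trans; cong; subst)
open import Relation.Unary using (_⊆_; _≐_)
open import Relation.Unary.Properties using (≐-sym; ≐-trans)

private
  variable
    n : ℕ

SupportedIn : (Fin n → Set) → Pred n
SupportedIn P x = ∀ i → lookup x i ≡ true → P i

supportedIn-mono : {P Q : Fin n → Set} → (∀ {i} → P i → Q i) → SupportedIn P ⊆ SupportedIn Q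
supportedIn-mono P⇒Q x⊑P i xᵢ≡true = P⇒Q (x⊑P i xᵢ≡true)

supportedIn-antiMonotone : {P : Fin n → Set} → AntiMonotone (SupportedIn P)
supportedIn-antiMonotone x y x⊑P y⪯x i yᵢ≡true = x⊑P i (≤-true (y⪯x i) yᵢ≡true)
  where
  ≤-true : ∀ {a b} → b ≤ a → b ≡ true → a ≡ true
  ≤-true b≤b refl = refl

supportedIn-isSubspace : {P : Fin n → Set} → IsSubspace (SupportedIn P)
supportedIn-isSubspace {P = P} = 𝟎-supported , ⊕-supported , ·-supported
  where
  𝟎-supported : SupportedIn P 𝟎
  𝟎-supported i 𝟎ᵢ≡true with () ← trans (sym (lookup-replicate i false)) 𝟎ᵢ≡true

  xor-true : ∀ a b → a xor b ≡ true → a ≡ true ⊎ b ≡ true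
  xor-true true  _ _ = inj₁ refl
  xor-true false _ b≡true = inj₂ b≡true

  ⊕-supported : ∀ x y → SupportedIn P x → SupportedIn P y → SupportedIn P (x ⊕ y)
  ⊕-supported x y x⊑P y⊑P i h =
    [ x⊑P i , y⊑P i ]′ (xor-true _ _ (trans (sym (lookup-zipWith _xor_ i x y)) h))

  ∧-trueʳ : ∀ c a → c ∧ a ≡ true → a ≡ true
  ∧-trueʳ true _ a≡true = a≡true

  ·-supported : ∀ c x → SupportedIn P x → SupportedIn P (c · x)
  ·-supported c x x⊑P i h = x⊑P i (∧-trueʳ c _ (trans (sym (lookup-map i (c ∧_) x)) h))

conjNeg≐supportedIn : (S : Subset n) →
  preimage1 (conjNeg S) ≐ SupportedIn (λ i → not (lookup S i) ≡ true)
conjNeg≐supportedIn S = sound S _ , complete S _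
  where
  sound : ∀ {n} (S : Subset n) x → conjNeg S x ≡ true →
          SupportedIn (λ i → not (lookup S i) ≡ true) x
  sound (false ∷ S) (_     ∷ x) _ zero    _ = refl
  sound (true  ∷ S) (false ∷ x) _ zero    ()
  sound (false ∷ S) (_     ∷ x) h (suc i) = sound S x h i
  sound (true  ∷ S) (false ∷ x) h (suc i) = sound S x h i

  complete : ∀ {n} (S : Subset n) x → SupportedIn (λ i → not (lookup S i) ≡ true) x →
             conjNeg S x ≡ true
  complete []          []          _   = refl
  complete (false ∷ S) (_     ∷ x) x⊑S = complete S x (λ i → x⊑S (suc i))
  complete (true  ∷ S) (false ∷ x) x⊑S = complete S x (λ i → x⊑S (suc i))
  complete (true  ∷ S) (true  ∷ x) x⊑S with () ← x⊑S zero refl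

preimage1-cong : {f g : Cube n → Bool} → f ≗ g → preimage1 f ≐ preimage1 g
preimage1-cong f≗g = (λ {x} fx≡true → trans (sym (f≗g x)) fx≡true)
                   , (λ {x} gx≡true → trans (f≗g x) gx≡true)

antiMonotone-resp : {H K : Pred n} → H ≐ K → AntiMonotone K → AntiMonotone H
antiMonotone-resp (H⊆K , K⊆H) K-anti x y x∈H y⪯x = K⊆H (K-anti x y (H⊆K x∈H) y⪯x)

isSubspace-resp : {H K : Pred n} → H ≐ K → IsSubspace K → IsSubspace H
isSubspace-resp (H⊆K , K⊆H) (𝟎∈K , K-⊕ , K-·) =
    K⊆H 𝟎∈K
  , (λ x y x∈H y∈H → K⊆H (K-⊕ x y (H⊆K x∈H) (H⊆K y∈H)))
  , (λ c x x∈H → K⊆H (K-· c x (H⊆K x∈H)))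

-- Cube n is Subset n, so the singleton ⁅ i ⁆ is the unit vector eᵢ.
⁅i⁆⪯ : (x : Cube n) (i : Fin n) → lookup x i ≡ true → ⁅ i ⁆ ⪯ x
⁅i⁆⪯ (_ ∷ _) zero    refl    zero    = b≤b
⁅i⁆⪯ (_ ∷ x) zero    _       (suc j) =
  subst (_≤ lookup x j) (sym (lookup-replicate j false)) (≤-minimum (lookup x j))
⁅i⁆⪯ (a ∷ _) (suc i) _       zero    = ≤-minimum a
⁅i⁆⪯ (_ ∷ x) (suc i) xᵢ≡true (suc j) = ⁅i⁆⪯ x i xᵢ≡true j

supportedIn-units⊆ : {H : Pred n} → H 𝟎 → (∀ x y → H x → H y → H (x ⊕ y)) →
                     SupportedIn (λ i → H ⁅ i ⁆) ⊆ H
supportedIn-units⊆ {zero}      𝟎∈H _        {[]}    _   = 𝟎∈H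
supportedIn-units⊆ {suc _} {H} 𝟎∈H H-⊕ {b ∷ x} x⊑H = with-head b (x⊑H zero)
  where
  tail∈H : H (false ∷ x)
  tail∈H = supportedIn-units⊆ {H = λ y → H (false ∷ y)} 𝟎∈H
             (λ y z → H-⊕ (false ∷ y) (false ∷ z)) (λ i → x⊑H (suc i))

  with-head : ∀ b → (b ≡ true → H ⁅ zero ⁆) → H (b ∷ x)
  with-head false _    = tail∈H
  with-head true  e₀∈H = subst (λ y → H (true ∷ y)) (zipWith-identityˡ xor-identityˡ x)
                           (H-⊕ ⁅ zero ⁆ (false ∷ x) (e₀∈H refl) tail∈H)

antiMonotone-isSubspace≐supportedIn : {H : Pred n} → AntiMonotone H → IsSubspace H →
                                      H ≐ SupportedIn (λ i → H ⁅ i ⁆)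
antiMonotone-isSubspace≐supportedIn H-anti (𝟎∈H , H-⊕ , _) =
    (λ {x} x∈H i xᵢ≡true → H-anti x ⁅ i ⁆ x∈H (⁅i⁆⪯ x i xᵢ≡true))
  , supportedIn-units⊆ 𝟎∈H H-⊕

lemma3p5 : (n : ℕ) (f : Cube n → Bool) →
    IsAntiMonotoneConj f ⇔ (AntiMonotone (preimage1 f) × IsSubspace (preimage1 f))
lemma3p5 n f = mk⇔ forward backward
  where
  forward : IsAntiMonotoneConj f → AntiMonotone (preimage1 f) × IsSubspace (preimage1 f)
  forward (S , f≗conjNeg) = antiMonotone-resp f≐ supportedIn-antiMonotone
                          , isSubspace-resp f≐ supportedIn-isSubspace
    where
    f≐ : preimage1 f ≐ SupportedIn (λ i → not (lookup S i) ≡ true)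
    f≐ = ≐-trans (preimage1-cong f≗conjNeg) (conjNeg≐supportedIn S)

  backward : AntiMonotone (preimage1 f) × IsSubspace (preimage1 f) → IsAntiMonotoneConj f
  backward (f-anti , f-subspace) = S , λ x → ⇔→≡ (mk⇔ (proj₁ f≐ {x}) (proj₂ f≐ {x}))
    where
    S : Subset n
    S = tabulate (λ i → not (f ⁅ i ⁆))

    unit-coordinate : ∀ i → not (lookup S i) ≡ f ⁅ i ⁆
    unit-coordinate i = trans (cong not (lookup∘tabulate _ i)) (not-involutive (f ⁅ i ⁆))

    units≐ : SupportedIn (λ i → f ⁅ i ⁆ ≡ true) ≐ SupportedIn (λ i → not (lookup S i) ≡ true)
    units≐ = (λ {x} → supportedIn-mono (λ {i} → subst (_≡ true) (sym (unit-coordinate i))) {x})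
           , (λ {x} → supportedIn-mono (λ {i} → subst (_≡ true) (unit-coordinate i)) {x})

    f≐ : preimage1 f ≐ preimage1 (conjNeg S)
    f≐ = ≐-trans (antiMonotone-isSubspace≐supportedIn f-anti f-subspace)
                 (≐-trans units≐ (≐-sym (conjNeg≐supportedIn S)))
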